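{- Let $r$ be a positive integer, let $G$ be a graph on $n$ vertices, and let $\mathcal{G}_0$ be the auxiliary graph defined from $G$ and $r$ (see context). Suppose $\mathcal{G}_0$ has average degree $d>0$. Then there exist $D_1,D_2\geq \frac{d}{4}$ and a non-empty bipartite subgraph $\mathcal{G}$ of $\mathcal{G}_0$ with parts $X_1$ and $X_2$ such that for every $x\in X_1$, $d_{\mathcal{G}}(x)\geq \frac{D_1}{256r^2(\log n)^2}$ and $d_{\mathcal{G}_0}(x)\leq D_1$, and for every $x\in X_2$, $d_{\mathcal{G}}(x)\geq \frac{D_2}{256r^2(\log n)^2}$ and $d_{\mathcal{G}_0}(x)\leq D_2$.
   Context: Given a graph $G$ and a positive integer $r$, the auxiliary graph $\mathcal{G}_0$ has as vertex set the family of all $r$-element subsets of $V(G)$, and two such sets $U,W$ are adjacent in $\mathcal{G}_0$ if $U\cap W=\emptyset$ and $uw\in E(G)$ for every $u\in U$ and $w\in W$. Logarithms are base 2. $d_H(x)$ denotes the degree of $x$ in $H$. -}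

module Defs where

open import Data.Bool using (Bool; true; false; T)
open import Data.Nat as ℕ using (ℕ; zero; suc; _+_; _*_; _^_)
open import Data.Nat.Properties using (_≟_)
open import Data.Integer using (+_)
open import Data.Rational as ℚ using (ℚ)
open import Data.Fin using (Fin)
open import Data.Fin.Properties using (all?)
open import Data.Fin.Subset using (Subset; _∈_; ∣_∣)
open import Data.Fin.Subset.Properties using (_∈?_)
open import Data.Vec using (_∷_; [])
open import Data.List using (List; []; _∷_; map; _++_; filter; length)
open import Data.Nat.ListAction using (sum)
open import Data.Product using (_×_; _,_)
import Data.Product
import Data.Sum
import Data.Empty
open import Relation.Nullary using (¬_; Dec; yes; no)
open import Relation.Nullary.Decidable using (_×-dec_; _→-dec_; ¬?)
open import Relation.Binary.PropositionalEquality using (_≡_)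

record Graph (n : ℕ) : Set where
  field
    adj   : Fin n → Fin n → Bool
    sym   : ∀ u v → adj u v ≡ adj v u
    irefl : ∀ v → adj v v ≡ false
open Graph public

allSubsets : (n : ℕ) → List (Subset n)
allSubsets zero = [] ∷ []
allSubsets (suc n) = map (true ∷_) (allSubsets n) ++ map (false ∷_) (allSubsets n)

-- The list of all r-element subsets of Fin n: the vertex set of 𝒢₀.
rSubsets : (n r : ℕ) → List (Subset n)
rSubsets n r = filter (λ U → ∣ U ∣ ≟ r) (allSubsets n)

Adj₀ : ∀ {n} → Graph n → Subset n → Subset n → Set
Adj₀ {n} G U W = (∀ x → ¬ (x ∈ U × x ∈ W)) × (∀ u → u ∈ U → ∀ w → w ∈ W → T (adj G u w))

Adj₀? : ∀ {n} (G : Graph n) (U W : Subset n) → Dec (Adj₀ G U W)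
Adj₀? G U W =
  all? (λ x → ¬? ((x ∈? U) ×-dec (x ∈? W)))
  ×-dec all? (λ u → (u ∈? U) →-dec all? (λ w → (w ∈? W) →-dec T? (adj G u w)))
  where
  T? : (b : Bool) → Dec (T b)
  T? true = yes _
  T? false = no (λ ())

deg₀ : ∀ {n} → Graph n → (r : ℕ) → Subset n → ℕ
deg₀ {n} G r U = length (filter (Adj₀? G U) (rSubsets n r))

degSum₀ : ∀ {n} → Graph n → ℕ → ℕ
degSum₀ {n} G r = sum (map (deg₀ G r) (rSubsets n r))

numVert₀ : ℕ → ℕ → ℕ
numVert₀ n r = length (rSubsets n r)

-- A bipartite subgraph 𝒢 of 𝒢₀ with parts X₁, X₂ (vertex set X₁ ∪ X₂).
record BipSub {n} (G : Graph n) (r : ℕ) : Set where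
  field
    X₁ X₂   : Subset n → Bool
    e       : Subset n → Subset n → Bool
    X₁-r    : ∀ U → T (X₁ U) → ∣ U ∣ ≡ r
    X₂-r    : ∀ U → T (X₂ U) → ∣ U ∣ ≡ r
    disj    : ∀ U → T (X₁ U) → T (X₂ U) → Data.Empty.⊥
    e-sym   : ∀ U W → e U W ≡ e W U
    e-sub   : ∀ U W → T (e U W) → Adj₀ G U W
    e-bip   : ∀ U W → T (e U W) → (T (X₁ U) × T (X₂ W)) Data.Sum.⊎ (T (X₂ U) × T (X₁ W))
open BipSub public

degB : ∀ {n} {G : Graph n} {r : ℕ} → BipSub G r → Subset n → ℕ
degB {n} {r = r} 𝒢 U = length (filter (λ W → T? (e 𝒢 U W)) (rSubsets n r))
  where
  T? : (b : Bool) → Dec (T b)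
  T? true = yes _
  T? false = no (λ ())

NonEmptyB : ∀ {n} {G : Graph n} {r : ℕ} → BipSub G r → Set
NonEmptyB {n} 𝒢 = Data.Product.∃ λ (U : Subset n) → T (X₁ 𝒢 U) Data.Sum.⊎ T (X₂ 𝒢 U)

ℕ→ℚ : ℕ → ℚ
ℕ→ℚ k = + k ℚ./ 1

-- q ≤ c · (log₂ n)²  (for a rational q, natural c and n ≥ 1), expressed without
-- reals: every nonnegative rational t = a/(b+1) with c·t² < q satisfies
-- t ≤ log₂ n, i.e. 2^a ≤ n^(b+1).
_≤_·log²_ : ℚ → ℕ → ℕ → Set
q ≤ c ·log² n = ∀ (a b : ℕ) →
  ℕ→ℚ c ℚ.* ((+ a ℚ./ suc b) ℚ.* (+ a ℚ./ suc b)) ℚ.< q → 2 ^ a ℕ.≤ n ^ suc b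

module Submission where

-- Keep the vertices of 𝒢₀ whose degree is at least a quarter of the average ("good" vertices):
-- they still span at least half of the edges. Sort them by the dyadic class ⌈log₂ d₀(U)⌉ of their
-- degree (at most L ≈ r log n classes) and, as adjacent U and W are disjoint, separate them by a
-- binary digit (one of B ≈ log n) in which their least elements differ. This covers the good edges
-- by L·L·B bipartite pieces. Weighting each vertex by 2^class ∈ [d₀, 2 d₀), the pieces have total
-- weight at most 4LB·s (s the degree sum of 𝒢₀) but at least s/2 edges, so one of them satisfies
-- 2·weight < K·edges with K = 1 + 16LB ≤ 256 r² log² n. Deleting a vertex of degree at most
-- weight/K preserves this inequality, so the deletions stop at a non-empty subgraph in which
-- every vertex of class i has degree larger than 2^i/K; D₁ and D₂ are 2^i and 2^j for the two
-- classes i, j of that piece.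

open import Algebra.Bundles using (CommutativeMonoid)
open import Data.Bool using (Bool; true; false; T; _∧_; _∨_; not)
import Data.Bool as Bool
open import Data.Bool.Properties using (T-∧; T-∨; ∧-comm; ∨-comm; ∧-identityʳ; ∧-commutativeMonoid)
open import Data.Empty using (⊥-elim)
import Data.Fin as Fin
open import Data.Fin.Subset as Subset using (Subset; ∣_∣)
import Data.Integer as ℤ
import Data.Integer.Properties as ℤ
open import Data.List using (List; []; _∷_; length; filter; map; _++_; cartesianProduct; downFrom)
open import Data.List.Membership.Propositional using (_∈_; find; lose)
open import Data.List.Membership.Propositional.Properties
  using (∈-cartesianProduct⁺; ∈-downFrom⁺; ∈-downFrom⁻; ∈-filter⁺; ∈-filter⁻; ∈-++⁺ˡ; ∈-++⁺ʳ; ∈-map⁺;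
         ∈-length)
import Data.List.Properties as List
open import Data.List.Relation.Unary.Any using (here; there; any?)
open import Data.Nat
  using (ℕ; zero; suc; _+_; _*_; _^_; _≤_; _<_; _≥_; z≤n; s≤s; _≤?_; _<?_; _≟_; _≡ᵇ_; _≤ᵇ_; ⌊_/2⌋; parity;
         NonZero; >-nonZero)
open import Data.Nat.Induction using (<-wellFounded)
open import Data.Nat.ListAction using (sum)
open import Data.Nat.Properties
open import Data.Nat.Tactic.RingSolver using (solve-∀)
open import Data.Parity using (Parity; 0ℙ; 1ℙ)
import Data.Parity.Properties as Parity
open import Data.Product using (Σ; Σ-syntax; _×_; _,_; proj₁; proj₂)
open import Data.Rational as ℚ using (ℚ; toℚᵘ)
import Data.Rational.Properties as ℚ
open import Data.Rational.Unnormalised as ℚᵘ using (ℚᵘ; mkℚᵘ; *≤*)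
import Data.Rational.Unnormalised.Properties as ℚᵘ
open import Data.Sum using (_⊎_; inj₁; inj₂; [_,_]′)
open import Data.Vec as Vec using ([]; _∷_)
import Data.Vec.Properties as Vec
open import Defs hiding (sym)
open import Function using (_∘′_; Equivalence)
open import Induction.WellFounded using (Acc; acc)
open import Relation.Binary.Definitions using (DecidableEquality)
open import Relation.Binary.PropositionalEquality
open import Relation.Nullary using (Dec; yes; no; does; ¬_)
open import Relation.Nullary.Decidable using (T?; _×-dec_; dec-true; dec-false)
open import Relation.Unary using (Pred; Decidable)
open import Algebra.Properties.CommutativeSemigroup +-commutativeSemigroup
  using () renaming (interchange to +-interchange)
open import Algebra.Properties.CommutativeSemigroup *-commutativeSemigroup
  using () renaming (x∙yz≈y∙xz to *-x∙yz≈y∙xz)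
open import Algebra.Properties.CommutativeSemigroup (CommutativeMonoid.commutativeSemigroup ∧-commutativeMonoid)
  using () renaming (x∙yz≈y∙xz to ∧-x∙yz≈y∙xz)

-- Indicators and finite sums

T-∧⁻ : ∀ a {b} → T (a ∧ b) → T a × T b
T-∧⁻ a = Equivalence.to (T-∧ {a})

T-∧⁺ : ∀ {a b} → T a → T b → T (a ∧ b)
T-∧⁺ {true} _ tb = tb

T-∨⁺ˡ : ∀ {a b} → T a → T (a ∨ b)
T-∨⁺ˡ = Equivalence.from T-∨ ∘′ inj₁

T-∨⁺ʳ : ∀ {a b} → T b → T (a ∨ b)
T-∨⁺ʳ = Equivalence.from T-∨ ∘′ inj₂

T-not⇒¬T : ∀ {b} → T (not b) → ¬ T b
T-not⇒¬T {true} ()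

does⇒ : ∀ {P : Set} (P? : Dec P) → T (does P?) → P
does⇒ (yes p) _ = p

⇒does : ∀ {P : Set} (P? : Dec P) → P → T (does P?)
⇒does P? p = subst T (sym (dec-true P? p)) _

does-⇔ : ∀ {P Q : Set} (P? : Dec P) (Q? : Dec Q) → (P → Q) → (Q → P) → does P? ≡ does Q?
does-⇔ (yes p) Q? to from = sym (dec-true Q? (to p))
does-⇔ (no ¬p) Q? to from = sym (dec-false Q? (¬p ∘′ from))

does-T : ∀ b (b? : Dec (T b)) → does b? ≡ b
does-T true b? = dec-true b? _
does-T false b? = dec-false b? (λ ())

𝟙 : Bool → ℕ
𝟙 true = 1
𝟙 false = 0

𝟙≤1 : ∀ b → 𝟙 b ≤ 1
𝟙≤1 true = ≤-refl
𝟙≤1 false = z≤n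

𝟙-∧ : ∀ a b → 𝟙 (a ∧ b) ≡ 𝟙 a * 𝟙 b
𝟙-∧ true b = sym (+-identityʳ (𝟙 b))
𝟙-∧ false b = refl

𝟙-T : ∀ {b} → T b → 𝟙 b ≡ 1
𝟙-T {true} _ = refl

𝟙-∨-≤ : ∀ a b → 𝟙 (a ∨ b) ≤ 𝟙 a + 𝟙 b
𝟙-∨-≤ true b = m≤m+n 1 (𝟙 b)
𝟙-∨-≤ false b = ≤-refl

𝟙-∧-≤ˡ : ∀ a b → 𝟙 (a ∧ b) ≤ 𝟙 a
𝟙-∧-≤ˡ true b = 𝟙≤1 b
𝟙-∧-≤ˡ false b = z≤n

𝟙-∧-≤ʳ : ∀ a b → 𝟙 (a ∧ b) ≤ 𝟙 b
𝟙-∧-≤ʳ true b = ≤-refl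
𝟙-∧-≤ʳ false b = z≤n

𝟙-guard-≤ : ∀ b {x y} → (T b → x ≤ y) → 𝟙 b * x ≤ 𝟙 b * y
𝟙-guard-≤ true x≤y = +-monoˡ-≤ 0 (x≤y _)
𝟙-guard-≤ false _ = z≤n

𝟙-positive : ∀ b → 0 < 𝟙 b → T b
𝟙-positive true _ = _

𝟙-*-positive : ∀ b {x} → 0 < 𝟙 b * x → T b × 0 < x
𝟙-*-positive true 0<x = _ , subst (0 <_) (+-identityʳ _) 0<x

𝟙³-≤ : ∀ a b e {x} → (T a → T b → T e → 1 ≤ x) → 𝟙 a * 𝟙 b * 𝟙 e ≤ x
𝟙³-≤ true true true bound = bound _ _ _
𝟙³-≤ true true false _ = z≤n
𝟙³-≤ true false _ _ = z≤n
𝟙³-≤ false _ _ _ = z≤n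

module _ {A : Set} where

  ∑ : List A → (A → ℕ) → ℕ
  ∑ [] f = 0
  ∑ (x ∷ xs) f = f x + ∑ xs f

  -- The body of ∑[ x ∈ xs ] extends over _+_ and _*_, but not over _≡_ or _≤_.
  infix 5 ∑
  syntax ∑ xs (λ x → e) = ∑[ x ∈ xs ] e

  ∑-cong : ∀ xs {f g : A → ℕ} → (∀ x → x ∈ xs → f x ≡ g x) → ∑ xs f ≡ ∑ xs g
  ∑-cong [] eq = refl
  ∑-cong (x ∷ xs) eq = cong₂ _+_ (eq x (here refl)) (∑-cong xs (λ y y∈ → eq y (there y∈)))

  ∑-mono-≤ : ∀ xs {f g : A → ℕ} → (∀ x → x ∈ xs → f x ≤ g x) → ∑ xs f ≤ ∑ xs g
  ∑-mono-≤ [] le = z≤n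
  ∑-mono-≤ (x ∷ xs) le = +-mono-≤ (le x (here refl)) (∑-mono-≤ xs (λ y y∈ → le y (there y∈)))

  ∑-distrib-+ : ∀ xs (f g : A → ℕ) → ∑[ x ∈ xs ] f x + g x ≡ ∑ xs f + ∑ xs g
  ∑-distrib-+ [] f g = refl
  ∑-distrib-+ (x ∷ xs) f g =
    trans (cong (f x + g x +_) (∑-distrib-+ xs f g)) (+-interchange (f x) (g x) (∑ xs f) (∑ xs g))

  ∑-*ˡ : ∀ xs c (f : A → ℕ) → ∑[ x ∈ xs ] c * f x ≡ c * ∑ xs f
  ∑-*ˡ [] c f = sym (*-zeroʳ c)
  ∑-*ˡ (x ∷ xs) c f = trans (cong (c * f x +_) (∑-*ˡ xs c f)) (sym (*-distribˡ-+ c (f x) (∑ xs f)))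

  ∑-const : ∀ xs c → ∑[ x ∈ xs ] c ≡ length xs * c
  ∑-const [] c = refl
  ∑-const (x ∷ xs) c = cong (c +_) (∑-const xs c)

  ∑-zero : ∀ xs → ∑[ x ∈ xs ] 0 ≡ 0
  ∑-zero xs = trans (∑-const xs 0) (*-zeroʳ (length xs))

  ∑-++ : ∀ xs ys (f : A → ℕ) → ∑ (xs ++ ys) f ≡ ∑ xs f + ∑ ys f
  ∑-++ [] ys f = refl
  ∑-++ (x ∷ xs) ys f = trans (cong (f x +_) (∑-++ xs ys f)) (sym (+-assoc (f x) _ _))

  term≤∑ : ∀ xs (f : A → ℕ) {x} → x ∈ xs → f x ≤ ∑ xs f
  term≤∑ (y ∷ xs) f (here refl) = m≤m+n (f y) _
  term≤∑ (y ∷ xs) f (there x∈) = ≤-trans (term≤∑ xs f x∈) (m≤n+m _ (f y))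

  ∑-<⇒∃< : ∀ xs (f g : A → ℕ) → ∑ xs f < ∑ xs g → Σ[ x ∈ A ] x ∈ xs × f x < g x
  ∑-<⇒∃< (x ∷ xs) f g lt with f x <? g x
  ... | yes fx<gx = x , here refl , fx<gx
  ... | no fx≮gx =
    let y , y∈ , fy<gy = ∑-<⇒∃< xs f g (+-cancelˡ-< (g x) _ _ (≤-<-trans (+-monoˡ-≤ _ (≮⇒≥ fx≮gx)) lt))
    in  y , there y∈ , fy<gy

  ∑-positive : ∀ xs (f : A → ℕ) → 0 < ∑ xs f → Σ[ x ∈ A ] x ∈ xs × 0 < f x
  ∑-positive xs f = ∑-<⇒∃< xs (λ _ → 0) f ∘′ subst (_< ∑ xs f) (sym (∑-zero xs))

  sum-map : ∀ xs (f : A → ℕ) → sum (map f xs) ≡ ∑ xs f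
  sum-map [] f = refl
  sum-map (x ∷ xs) f = cong (f x +_) (sum-map xs f)

  length-filter-∑ : ∀ {p} {P : Pred A p} (P? : Decidable P) xs →
    length (filter P? xs) ≡ ∑[ x ∈ xs ] 𝟙 (does (P? x))
  length-filter-∑ P? [] = refl
  length-filter-∑ P? (x ∷ xs) with does (P? x)
  ... | true = cong suc (length-filter-∑ P? xs)
  ... | false = length-filter-∑ P? xs

  length-filter-T : ∀ (f : A → Bool) (P? : ∀ x → Dec (T (f x))) xs → length (filter P? xs) ≡ ∑[ x ∈ xs ] 𝟙 (f x)
  length-filter-T f P? xs = trans (length-filter-∑ P? xs) (∑-cong xs λ x _ → cong 𝟙 (does-T (f x) (P? x)))

∑-comm : ∀ {A B : Set} (xs : List A) (ys : List B) (f : A → B → ℕ) →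
  ∑[ x ∈ xs ] ∑[ y ∈ ys ] f x y ≡ ∑[ y ∈ ys ] ∑[ x ∈ xs ] f x y
∑-comm [] ys f = sym (∑-zero ys)
∑-comm (x ∷ xs) ys f =
  trans (cong (∑ ys (f x) +_) (∑-comm xs ys f)) (sym (∑-distrib-+ ys (f x) (λ y → ∑[ x ∈ xs ] f x y)))

∑-map : ∀ {A B : Set} (g : B → A) xs (f : A → ℕ) → ∑ (map g xs) f ≡ ∑[ x ∈ xs ] f (g x)
∑-map g [] f = refl
∑-map g (x ∷ xs) f = cong (f (g x) +_) (∑-map g xs f)

∑-cartesianProduct : ∀ {A B : Set} (xs : List A) (ys : List B) (f : A × B → ℕ) →
  ∑ (cartesianProduct xs ys) f ≡ ∑[ x ∈ xs ] ∑[ y ∈ ys ] f (x , y)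
∑-cartesianProduct [] ys f = refl
∑-cartesianProduct (x ∷ xs) ys f =
  trans (∑-++ (map (x ,_) ys) _ f) (cong₂ _+_ (∑-map (x ,_) ys f) (∑-cartesianProduct xs ys f))

∑-downFrom-≡ᵇ≤1 : ∀ m l → ∑[ i ∈ downFrom l ] 𝟙 (m ≡ᵇ i) ≤ 1
∑-downFrom-≡ᵇ≤1 m zero = z≤n
∑-downFrom-≡ᵇ≤1 m (suc l) with m ≟ l
... | yes refl =
  ≤-reflexive (cong₂ _+_ (cong 𝟙 (dec-true (m ≟ m) refl)) (trans (∑-cong (downFrom m) absent) (∑-zero (downFrom m))))
  where
  absent : ∀ i → i ∈ downFrom m → 𝟙 (m ≡ᵇ i) ≡ 0
  absent i i∈ = cong 𝟙 (dec-false (m ≟ i) (>⇒≢ (∈-downFrom⁻ i∈)))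
... | no m≢l = subst (_≤ 1) (cong (λ b → 𝟙 b + (∑[ i ∈ downFrom l ] 𝟙 (m ≡ᵇ i))) (sym (dec-false (m ≟ l) m≢l)))
                 (∑-downFrom-≡ᵇ≤1 m l)

∑-downFrom-const : ∀ l c → ∑[ i ∈ downFrom l ] c ≡ l * c
∑-downFrom-const l c = trans (∑-const (downFrom l) c) (cong (_* c) (List.length-downFrom l))

∑-downFrom²-≡ᵇ : ∀ m l → ∑[ i ∈ downFrom l ] ∑[ j ∈ downFrom l ] 𝟙 (m ≡ᵇ i) + 𝟙 (m ≡ᵇ j) ≤ 2 * l
∑-downFrom²-≡ᵇ m l = begin
  ∑[ i ∈ downFrom l ] ∑[ j ∈ downFrom l ] 𝟙 (m ≡ᵇ i) + 𝟙 (m ≡ᵇ j)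
    ≡⟨ ∑-cong (downFrom l) (λ i _ → trans (∑-distrib-+ (downFrom l) _ _) (cong (_+ hits) (∑-downFrom-const l _))) ⟩
  ∑[ i ∈ downFrom l ] l * 𝟙 (m ≡ᵇ i) + hits
    ≡⟨ trans (∑-distrib-+ (downFrom l) _ _)
         (cong₂ _+_ (∑-*ˡ (downFrom l) l (λ i → 𝟙 (m ≡ᵇ i))) (∑-downFrom-const l hits)) ⟩
  l * hits + l * hits
    ≤⟨ +-mono-≤ (*-monoʳ-≤ l (∑-downFrom-≡ᵇ≤1 m l)) (*-monoʳ-≤ l (∑-downFrom-≡ᵇ≤1 m l)) ⟩
  l * 1 + l * 1
    ≡⟨ double l ⟩
  2 * l ∎
  where
  open ≤-Reasoning
  hits : ℕ
  hits = ∑[ j ∈ downFrom l ] 𝟙 (m ≡ᵇ j)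
  double : ∀ l → l * 1 + l * 1 ≡ 2 * l
  double = solve-∀

-- Dense subgraphs of finite graphs

module HighDegree {A : Set} (V : List A) (adj : A → A → Bool) (adj-sym : ∀ x y → adj x y ≡ adj y x) where

  degree : A → ℕ
  degree y = ∑[ w ∈ V ] 𝟙 (adj y w)

  edgesWithin : (A → Bool) → ℕ
  edgesWithin P = ∑[ y ∈ V ] ∑[ w ∈ V ] 𝟙 (P y) * 𝟙 (P w) * 𝟙 (adj y w)

  degreeOutside : (A → Bool) → ℕ
  degreeOutside P = ∑[ y ∈ V ] 𝟙 (not (P y)) * degree y

  degree-split : ∀ P → ∑ V degree ≤ edgesWithin P + 2 * degreeOutside P
  degree-split P = begin
    ∑ V degree
      ≤⟨ ∑-mono-≤ V (λ y _ → ∑-mono-≤ V λ w _ → split (P y) (P w) (adj y w)) ⟩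
    ∑[ y ∈ V ] ∑[ w ∈ V ] inside y w + (leaving y w + entering y w)
      ≡⟨ trans (∑-cong V λ y _ → trans (∑-distrib-+ V _ _) (cong (∑ V (inside y) +_) (∑-distrib-+ V _ _)))
           (trans (∑-distrib-+ V _ _) (cong (edgesWithin P +_) (∑-distrib-+ V _ _))) ⟩
    edgesWithin P + ((∑[ y ∈ V ] ∑ V (leaving y)) + (∑[ y ∈ V ] ∑ V (entering y)))
      ≡⟨ cong (edgesWithin P +_) (cong₂ _+_ ∑leaving ∑entering) ⟩
    edgesWithin P + (degreeOutside P + degreeOutside P)
      ≡⟨ cong (λ t → edgesWithin P + (degreeOutside P + t)) (+-identityʳ _) ⟨
    edgesWithin P + 2 * degreeOutside P ∎
    where
    open ≤-Reasoning
    inside leaving entering : A → A → ℕ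
    inside y w = 𝟙 (P y) * 𝟙 (P w) * 𝟙 (adj y w)
    leaving y w = 𝟙 (not (P y)) * 𝟙 (adj y w)
    entering y w = 𝟙 (not (P w)) * 𝟙 (adj y w)
    split : ∀ p q a → 𝟙 a ≤ 𝟙 p * 𝟙 q * 𝟙 a + (𝟙 (not p) * 𝟙 a + 𝟙 (not q) * 𝟙 a)
    split p q false = z≤n
    split true true true = s≤s z≤n
    split true false true = s≤s z≤n
    split false q true = s≤s z≤n
    ∑leaving : ∑[ y ∈ V ] ∑ V (leaving y) ≡ degreeOutside P
    ∑leaving = ∑-cong V (λ y _ → ∑-*ˡ V (𝟙 (not (P y))) _)
    ∑entering : ∑[ y ∈ V ] ∑ V (entering y) ≡ degreeOutside P
    ∑entering = trans (∑-comm V V entering) (∑-cong V λ w _ →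
      trans (∑-*ˡ V (𝟙 (not (P w))) _) (cong (𝟙 (not (P w)) *_) (∑-cong V λ y _ → cong 𝟙 (adj-sym y w))))

  high-degree-edges : .{{NonZero (length V)}} → ∀ P →
    (∀ y → y ∈ V → T (not (P y)) → 4 * length V * degree y ≤ ∑ V degree) → ∑ V degree ≤ 2 * edgesWithin P
  high-degree-edges P low = *-cancelˡ-≤ (2 * N) {{m*n≢0 2 N}} (+-cancelʳ-≤ (2 * N * D) _ _ (begin
    2 * N * D + 2 * N * D              ≡⟨ double N D ⟩
    4 * N * D                          ≤⟨ *-monoʳ-≤ (4 * N) (degree-split P) ⟩
    4 * N * (edgesWithin P + 2 * O)    ≡⟨ expand N (edgesWithin P) O ⟩
    2 * N * (2 * edgesWithin P) + 2 * (4 * N * O)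
                                       ≤⟨ +-monoʳ-≤ (2 * N * (2 * edgesWithin P)) (*-monoʳ-≤ 2 outside-small) ⟩
    2 * N * (2 * edgesWithin P) + 2 * (N * D) ≡⟨ cong (2 * N * (2 * edgesWithin P) +_) (*-assoc 2 N D) ⟨
    2 * N * (2 * edgesWithin P) + 2 * N * D ∎))
    where
    open ≤-Reasoning
    N D O : ℕ
    N = length V
    D = ∑ V degree
    O = degreeOutside P
    double : ∀ N D → 2 * N * D + 2 * N * D ≡ 4 * N * D
    double = solve-∀
    expand : ∀ N e o → 4 * N * (e + 2 * o) ≡ 2 * N * (2 * e) + 2 * (4 * N * o)
    expand = solve-∀
    outside-small : 4 * N * O ≤ N * D
    outside-small = begin
      4 * N * O                                  ≡⟨ ∑-*ˡ V (4 * N) _ ⟨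
      ∑[ y ∈ V ] 4 * N * (𝟙 (not (P y)) * degree y) ≤⟨ ∑-mono-≤ V (λ y y∈V → pointwise y y∈V) ⟩
      ∑[ y ∈ V ] D                               ≡⟨ ∑-const V D ⟩
      N * D                                      ∎
      where
      pointwise : ∀ y → y ∈ V → 4 * N * (𝟙 (not (P y)) * degree y) ≤ D
      pointwise y y∈V with P y in eq
      ... | true = ≤-trans (≤-reflexive (*-zeroʳ (4 * N))) z≤n
      ... | false =
        ≤-trans (≤-reflexive (cong (4 * N *_) (+-identityʳ (degree y)))) (low y y∈V (subst (λ b → T (not b)) (sym eq) _))

module Peeling {A : Set} (_≟_ : DecidableEquality A) (V : List A)
  (E : A → A → Bool) (E-sym : ∀ x y → E x y ≡ E y x) (W : A → ℕ) (K : ℕ) where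

  mass : (A → Bool) → (A → ℕ) → ℕ
  mass S F = ∑[ y ∈ V ] 𝟙 (S y) * F y

  deg : (A → Bool) → A → ℕ
  deg S x = mass S (λ w → 𝟙 (E x w))

  vol : (A → Bool) → ℕ
  vol S = mass S (deg S)

  Dense : (A → Bool) → Set
  Dense S = 2 * mass S W < K * vol S

  -- V may list a vertex several times; S ─ x deletes all of its copies.
  _─_ : (A → Bool) → A → A → Bool
  (S ─ x) y = S y ∧ not (does (y ≟ x))

  multiplicity : A → ℕ
  multiplicity x = ∑[ y ∈ V ] 𝟙 (does (y ≟ x))

  multiplicity-pos : ∀ {x} → x ∈ V → 0 < multiplicity x
  multiplicity-pos {x} x∈V =
    ≤-trans (≤-reflexive (cong 𝟙 (sym (dec-true (x ≟ x) refl)))) (term≤∑ V (λ y → 𝟙 (does (y ≟ x))) x∈V)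

  mass-+ : ∀ S F G → mass S (λ y → F y + G y) ≡ mass S F + mass S G
  mass-+ S F G = trans (∑-cong V (λ y _ → *-distribˡ-+ (𝟙 (S y)) (F y) (G y))) (∑-distrib-+ V _ _)

  mass-─ : ∀ S x F → T (S x) → mass S F ≡ mass (S ─ x) F + multiplicity x * F x
  mass-─ S x F Sx = trans (∑-cong V (λ y _ → split y)) (trans (∑-distrib-+ V _ _) (cong (mass (S ─ x) F +_) rest))
    where
    split : ∀ y → 𝟙 (S y) * F y ≡ 𝟙 ((S ─ x) y) * F y + F x * 𝟙 (does (y ≟ x))
    split y with y ≟ x
    ... | yes refl = kept (S y) Sx
      where
      kept : ∀ b → T b → 𝟙 b * F y ≡ 𝟙 (b ∧ false) * F y + F y * 1
      kept true _ = trans (+-identityʳ (F y)) (sym (*-identityʳ (F y)))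
    ... | no _ = begin
      𝟙 (S y) * F y                         ≡⟨ cong (λ b → 𝟙 b * F y) (∧-identityʳ (S y)) ⟨
      𝟙 (S y ∧ true) * F y                  ≡⟨ +-identityʳ _ ⟨
      𝟙 (S y ∧ true) * F y + 0              ≡⟨ cong (𝟙 (S y ∧ true) * F y +_) (*-zeroʳ (F x)) ⟨
      𝟙 (S y ∧ true) * F y + F x * 0        ∎
      where open ≡-Reasoning
    rest : ∑[ y ∈ V ] F x * 𝟙 (does (y ≟ x)) ≡ multiplicity x * F x
    rest = trans (∑-*ˡ V (F x) _) (*-comm (F x) (multiplicity x))

  mass-*ˡ : ∀ S c F → mass S (λ y → c * F y) ≡ c * mass S F
  mass-*ˡ S c F = trans (∑-cong V (λ y _ → *-x∙yz≈y∙xz (𝟙 (S y)) c (F y))) (∑-*ˡ V c _)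

  mass-─-≤ : ∀ S x F → T (S x) → mass (S ─ x) F ≤ mass S F
  mass-─-≤ S x F Sx = ≤-trans (m≤m+n _ _) (≤-reflexive (sym (mass-─ S x F Sx)))

  vol-─ : ∀ S x → T (S x) → vol S ≤ vol (S ─ x) + 2 * (multiplicity x * deg S x)
  vol-─ S x Sx = begin
    vol S
      ≡⟨ mass-─ S x (deg S) Sx ⟩
    mass (S ─ x) (deg S) + m * deg S x
      ≡⟨ cong (_+ m * deg S x) (∑-cong V λ y _ → cong (𝟙 ((S ─ x) y) *_) (mass-─ S x _ Sx)) ⟩
    mass (S ─ x) (λ y → deg (S ─ x) y + m * 𝟙 (E y x)) + m * deg S x
      ≡⟨ cong (_+ m * deg S x) (mass-+ (S ─ x) _ _) ⟩
    vol (S ─ x) + mass (S ─ x) (λ y → m * 𝟙 (E y x)) + m * deg S x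
      ≡⟨ cong (λ t → vol (S ─ x) + t + m * deg S x) (mass-*ˡ (S ─ x) m _) ⟩
    vol (S ─ x) + m * mass (S ─ x) (λ y → 𝟙 (E y x)) + m * deg S x
      ≤⟨ +-monoˡ-≤ _ (+-monoʳ-≤ (vol (S ─ x)) (*-monoʳ-≤ m back-edges)) ⟩
    vol (S ─ x) + m * deg S x + m * deg S x
      ≡⟨ +-assoc (vol (S ─ x)) _ _ ⟩
    vol (S ─ x) + (m * deg S x + m * deg S x)
      ≡⟨ cong (vol (S ─ x) +_) (cong (m * deg S x +_) (+-identityʳ _)) ⟨
    vol (S ─ x) + 2 * (m * deg S x) ∎
    where
    open ≤-Reasoning
    m : ℕ
    m = multiplicity x
    back-edges : mass (S ─ x) (λ y → 𝟙 (E y x)) ≤ deg S x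
    back-edges = ≤-trans (mass-─-≤ S x _ Sx) (≤-reflexive (∑-cong V λ y _ → cong (λ b → 𝟙 (S y) * 𝟙 b) (E-sym y x)))

  Dense-─ : ∀ S x → T (S x) → K * deg S x ≤ W x → Dense S → Dense (S ─ x)
  Dense-─ S x Sx low dense = +-cancelʳ-< _ (2 * mass (S ─ x) W) (K * vol (S ─ x)) (begin-strict
    2 * mass (S ─ x) W + 2 * (m * W x)          ≡⟨ *-distribˡ-+ 2 (mass (S ─ x) W) (m * W x) ⟨
    2 * (mass (S ─ x) W + m * W x)              ≡⟨ cong (2 *_) (mass-─ S x W Sx) ⟨
    2 * mass S W                                <⟨ dense ⟩
    K * vol S                                   ≤⟨ *-monoʳ-≤ K (vol-─ S x Sx) ⟩
    K * (vol (S ─ x) + 2 * (m * deg S x))       ≡⟨ *-distribˡ-+ K (vol (S ─ x)) _ ⟩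
    K * vol (S ─ x) + K * (2 * (m * deg S x))   ≡⟨ cong (K * vol (S ─ x) +_) reorder ⟩
    K * vol (S ─ x) + 2 * (m * (K * deg S x))   ≤⟨ +-monoʳ-≤ (K * vol (S ─ x)) (*-monoʳ-≤ 2 (*-monoʳ-≤ m low)) ⟩
    K * vol (S ─ x) + 2 * (m * W x)             ∎)
    where
    open ≤-Reasoning
    m : ℕ
    m = multiplicity x
    reorder : K * (2 * (m * deg S x)) ≡ 2 * (m * (K * deg S x))
    reorder = trans (*-x∙yz≈y∙xz K 2 _) (cong (2 *_) (*-x∙yz≈y∙xz K m _))

  size : (A → Bool) → ℕ
  size S = mass S (λ _ → 1)

  size-─ : ∀ S x → x ∈ V → T (S x) → size (S ─ x) < size S
  size-─ S x x∈V Sx = begin-strict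
    size (S ─ x)                       <⟨ m<m+n (size (S ─ x)) (subst (0 <_) (sym (*-identityʳ _)) (multiplicity-pos x∈V)) ⟩
    size (S ─ x) + multiplicity x * 1  ≡⟨ mass-─ S x _ Sx ⟨
    size S                             ∎
    where open ≤-Reasoning

  Robust : (A → Bool) → Set
  Robust S = ∀ y → y ∈ V → T (S y) → W y < K * deg S y

  peel : ∀ S → Dense S → Σ[ S′ ∈ (A → Bool) ] Dense S′ × Robust S′
  peel S = go S (<-wellFounded (size S))
    where
    go : ∀ S → Acc _<_ (size S) → Dense S → Σ[ S′ ∈ (A → Bool) ] Dense S′ × Robust S′
    go S (acc rec) dense with any? (λ x → T? (S x) ×-dec (K * deg S x ≤? W x)) V
    ... | yes removable =
      let x , x∈V , Sx , low = find removable
      in  go (S ─ x) (rec (size-─ S x x∈V Sx)) (Dense-─ S x Sx low dense)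
    ... | no none = S , dense , λ y y∈V Sy → ≰⇒> (λ low → none (lose y∈V (Sy , low)))

  Dense⇒edge : ∀ {S} → Dense S → Σ[ y ∈ A ] Σ[ w ∈ A ] T (S y) × T (S w) × T (E y w)
  Dense⇒edge {S} dense =
    let y , _ , 0<y = ∑-positive V _ (0<vol (≤-<-trans z≤n dense))
        Sy , 0<deg = 𝟙-*-positive (S y) 0<y
        w , _ , 0<w = ∑-positive V _ 0<deg
        Sw , 0<e = 𝟙-*-positive (S w) 0<w
    in  y , w , Sy , Sw , 𝟙-positive _ 0<e
    where
    0<vol : 0 < K * vol S → 0 < vol S
    0<vol 0<Kvol = n≢0⇒n>0 λ vol≡0 → <-irrefl (sym (trans (cong (K *_) vol≡0) (*-zeroʳ K))) 0<Kvol

-- Dyadic exponents and binary digits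

dyadic-cover : ∀ m → Σ[ e ∈ ℕ ] suc m ≤ 2 ^ e × 2 ^ e < 2 * suc m
dyadic-cover zero = 0 , ≤-refl , s≤s (s≤s z≤n)
dyadic-cover (suc m) with dyadic-cover m
... | e , m<2^e , 2^e<2m with suc (suc m) ≤? 2 ^ e
...   | yes fits = e , fits , <-≤-trans 2^e<2m (*-monoʳ-≤ 2 (n≤1+n (suc m)))
...   | no too-small = suc e , ≤-trans (m≤m+n (2 + m) m) (≤-trans (≤-reflexive (double m)) (*-monoʳ-≤ 2 m<2^e))
                            , *-monoʳ-< 2 (≰⇒> too-small)
  where
  double : ∀ m → 2 + m + m ≡ 2 * suc m
  double = solve-∀

clog₂ : ℕ → ℕ
clog₂ zero = 0
clog₂ (suc m) = proj₁ (dyadic-cover m)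

m≤2^clog₂m : ∀ {m} → 0 < m → m ≤ 2 ^ clog₂ m
m≤2^clog₂m {suc m} _ = proj₁ (proj₂ (dyadic-cover m))

2^clog₂m<2m : ∀ {m} → 0 < m → 2 ^ clog₂ m < 2 * m
2^clog₂m<2m {suc m} _ = proj₂ (proj₂ (dyadic-cover m))

2^-cancel-≤ : ∀ {m n} → 2 ^ m ≤ 2 ^ n → m ≤ n
2^-cancel-≤ 2^m≤2^n = ≮⇒≥ (λ n<m → <⇒≱ (^-monoʳ-< 2 (s≤s (s≤s z≤n)) n<m) 2^m≤2^n)

2^-cancel-< : ∀ {m n} → 2 ^ m < 2 ^ n → m < n
2^-cancel-< 2^m<2^n = ≰⇒> (λ n≤m → <⇒≱ 2^m<2^n (^-monoʳ-≤ 2 n≤m))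

exponent-bound : ∀ m e p q a → 2 ^ e ≤ m ^ p → m ^ q ≤ 2 ^ a → e * q ≤ p * a
exponent-bound m e p q a 2^e≤m^p m^q≤2^a = subst (e * q ≤_) (*-comm a p) (2^-cancel-≤ (begin
  2 ^ (e * q)   ≡⟨ ^-*-assoc 2 e q ⟨
  (2 ^ e) ^ q   ≤⟨ ^-monoˡ-≤ q 2^e≤m^p ⟩
  (m ^ p) ^ q   ≡⟨ ^-*-assoc m p q ⟩
  m ^ (p * q)   ≡⟨ cong (m ^_) (*-comm p q) ⟩
  m ^ (q * p)   ≡⟨ ^-*-assoc m q p ⟨
  (m ^ q) ^ p   ≤⟨ ^-monoˡ-≤ p m^q≤2^a ⟩
  (2 ^ a) ^ p   ≡⟨ ^-*-assoc 2 a p ⟩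
  2 ^ (a * p)   ∎))
  where open ≤-Reasoning

log²-bound : ∀ {r n N B I t a} → 1 ≤ r → 2 ≤ n → N ≤ n ^ r → 2 ^ B < 2 * n → 2 ^ I < 2 * N → n ^ t ≤ 2 ^ a →
  (1 + 16 * (suc I * B)) * (t * t) ≤ 256 * (r * r) * (a * a)
log²-bound {r@(suc _)} {n} {N} {B} {I} {t} {a} _ 2≤n N≤n^r 2^B<2n 2^I<2N n^t≤2^a = begin
  (1 + 16 * (suc I * B)) * (t * t)         ≡⟨ regroup (suc I) B t ⟩
  t * t + 16 * ((suc I * t) * (B * t))     ≤⟨ +-mono-≤ (*-mono-≤ t≤a t≤a) (*-monoʳ-≤ 16 (*-mono-≤ Lt≤[2+r]a Bt≤2a)) ⟩
  a * a + 16 * (((2 + r) * a) * (2 * a))   ≡⟨ expand r a ⟩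
  (65 + 32 * r) * (a * a)                  ≤⟨ *-monoˡ-≤ (a * a) 65+32r≤256r² ⟩
  256 * (r * r) * (a * a)                  ∎
  where
  open ≤-Reasoning
  regroup : ∀ L B t → (1 + 16 * (L * B)) * (t * t) ≡ t * t + 16 * ((L * t) * (B * t))
  regroup = solve-∀
  expand : ∀ r a → a * a + 16 * (((2 + r) * a) * (2 * a)) ≡ (65 + 32 * r) * (a * a)
  expand = solve-∀
  65+32r≤256r² : 65 + 32 * r ≤ 256 * (r * r)
  65+32r≤256r² = ≤-trans (+-monoˡ-≤ (32 * r) (m≤m*n 65 r))
    (≤-trans (≤-reflexive (sym (*-distribʳ-+ r 65 32)))
    (≤-trans (*-monoˡ-≤ r (m≤m+n 97 159)) (≤-trans (m≤m*n (256 * r) r) (≤-reflexive (*-assoc 256 r r)))))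
  t≤a : t ≤ a
  t≤a = 2^-cancel-≤ (≤-trans (^-monoˡ-≤ t 2≤n) n^t≤2^a)
  2n≤n² : 2 * n ≤ n ^ 2
  2n≤n² = ≤-trans (*-monoˡ-≤ n 2≤n) (≤-reflexive (cong (n *_) (sym (*-identityʳ n))))
  Bt≤2a : B * t ≤ 2 * a
  Bt≤2a = exponent-bound n B 2 t a (<⇒≤ (<-≤-trans 2^B<2n 2n≤n²)) n^t≤2^a
  2^I≤n^[1+r] : 2 ^ I ≤ n ^ suc r
  2^I≤n^[1+r] = <⇒≤ (<-≤-trans 2^I<2N (*-mono-≤ 2≤n N≤n^r))
  Lt≤[2+r]a : suc I * t ≤ (2 + r) * a
  Lt≤[2+r]a = +-mono-≤ t≤a (exponent-bound n I (suc r) t a 2^I≤n^[1+r] n^t≤2^a)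

0ℙ≢1ℙ : 0ℙ ≢ 1ℙ
0ℙ≢1ℙ ()

digit : ℕ → ℕ → Parity
digit zero m = parity m
digit (suc k) m = digit k ⌊ m /2⌋

parity-⌊/2⌋-injective : ∀ m m′ → parity m ≡ parity m′ → ⌊ m /2⌋ ≡ ⌊ m′ /2⌋ → m ≡ m′
parity-⌊/2⌋-injective zero zero _ _ = refl
parity-⌊/2⌋-injective (suc zero) (suc zero) _ _ = refl
parity-⌊/2⌋-injective (suc (suc m)) (suc (suc m′)) p h =
  cong (suc ∘′ suc) (parity-⌊/2⌋-injective m m′ p (suc-injective h))
parity-⌊/2⌋-injective zero (suc zero) () _
parity-⌊/2⌋-injective (suc zero) zero () _
parity-⌊/2⌋-injective zero (suc (suc m′)) _ ()
parity-⌊/2⌋-injective (suc zero) (suc (suc m′)) _ ()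
parity-⌊/2⌋-injective (suc (suc m)) zero _ ()
parity-⌊/2⌋-injective (suc (suc m)) (suc zero) _ ()

⌊m/2⌋<n : ∀ {m n} → m < 2 * n → ⌊ m /2⌋ < n
⌊m/2⌋<n {m} {n} m<2n = *-cancelˡ-< 2 ⌊ m /2⌋ n (≤-<-trans twice-half≤m m<2n)
  where
  twice-half≤m : 2 * ⌊ m /2⌋ ≤ m
  twice-half≤m = ≤-trans (≤-reflexive (cong (⌊ m /2⌋ +_) (+-identityʳ _)))
    (≤-trans (+-monoʳ-≤ ⌊ m /2⌋ (⌊n/2⌋≤⌈n/2⌉ m)) (≤-reflexive (⌊n/2⌋+⌈n/2⌉≡n m)))

digits-separate : ∀ B {m m′} → m < 2 ^ B → m′ < 2 ^ B → m ≢ m′ → Σ[ k ∈ ℕ ] k < B × digit k m ≢ digit k m′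
digits-separate zero {zero} {zero} _ _ m≢m′ = ⊥-elim (m≢m′ refl)
digits-separate zero {suc _} (s≤s ()) _ _
digits-separate zero {_} {suc _} _ (s≤s ()) _
digits-separate (suc B) {m} {m′} m< m′< m≢m′ with parity m Parity.≟ parity m′
... | no differ = 0 , s≤s z≤n , differ
... | yes same =
  let k , k<B , differ = digits-separate B (⌊m/2⌋<n m<) (⌊m/2⌋<n m′<) (m≢m′ ∘′ parity-⌊/2⌋-injective m m′ same)
  in  suc k , s≤s k<B , differ

distinct-below⇒2≤ : ∀ {a b n} → a < n → b < n → a ≢ b → 2 ≤ n
distinct-below⇒2≤ {n = suc (suc _)} _ _ _ = s≤s (s≤s z≤n)
distinct-below⇒2≤ {zero} {zero} {suc zero} _ _ a≢b = ⊥-elim (a≢b refl)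
distinct-below⇒2≤ {suc _} {n = suc zero} (s≤s ()) _ _
distinct-below⇒2≤ {b = suc _} {n = suc zero} _ (s≤s ()) _

-- r-subsets

least : ∀ {n} → Subset n → ℕ
least [] = 0
least (true ∷ U) = 0
least (false ∷ U) = suc (least U)

least<n : ∀ {n} (U : Subset n) → 0 < ∣ U ∣ → least U < n
least<n (true ∷ U) _ = s≤s z≤n
least<n (false ∷ U) 0<∣U∣ = s≤s (least<n U 0<∣U∣)

least-disjoint : ∀ {n} (U W : Subset n) → (∀ x → ¬ (x Subset.∈ U × x Subset.∈ W)) → 0 < ∣ U ∣ → 0 < ∣ W ∣ →
  least U ≢ least W
least-disjoint (true ∷ U) (true ∷ W) disjoint _ _ _ = disjoint Fin.zero (Vec.here , Vec.here)
least-disjoint (false ∷ U) (false ∷ W) disjoint 0<∣U∣ 0<∣W∣ same =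
  least-disjoint U W (λ x (x∈U , x∈W) → disjoint (Fin.suc x) (Vec.there x∈U , Vec.there x∈W)) 0<∣U∣ 0<∣W∣
    (suc-injective same)
least-disjoint (true ∷ U) (false ∷ W) _ _ _ ()
least-disjoint (false ∷ U) (true ∷ W) _ _ _ ()

∈-allSubsets : ∀ {n} (U : Subset n) → U ∈ allSubsets n
∈-allSubsets [] = here refl
∈-allSubsets (true ∷ U) = ∈-++⁺ˡ (∈-map⁺ (true ∷_) (∈-allSubsets U))
∈-allSubsets {suc n} (false ∷ U) = ∈-++⁺ʳ (map (true ∷_) (allSubsets n)) (∈-map⁺ (false ∷_) (∈-allSubsets U))

∈-rSubsets⁺ : ∀ {n r} {U : Subset n} → ∣ U ∣ ≡ r → U ∈ rSubsets n r
∈-rSubsets⁺ {U = U} ∣U∣≡r = ∈-filter⁺ (λ U → ∣ U ∣ ≟ _) (∈-allSubsets U) ∣U∣≡r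

∈-rSubsets⁻ : ∀ {n r} {U : Subset n} → U ∈ rSubsets n r → ∣ U ∣ ≡ r
∈-rSubsets⁻ {n} U∈ = proj₂ (∈-filter⁻ (λ U → ∣ U ∣ ≟ _) {xs = allSubsets n} U∈)

numVert₀≤n^r : ∀ n r → numVert₀ n r ≤ n ^ r
numVert₀≤n^r n r = ≤-trans (≤-reflexive (length-filter-∑ (λ U → ∣ U ∣ ≟ r) (allSubsets n))) (count≤n^r n r)
  where
  count : ℕ → ℕ → ℕ
  count n r = ∑[ U ∈ allSubsets n ] 𝟙 (does (∣ U ∣ ≟ r))

  count-suc : ∀ n r → count (suc n) r ≡ (∑[ U ∈ allSubsets n ] 𝟙 (does (suc ∣ U ∣ ≟ r))) + count n r
  count-suc n r = trans (∑-++ (map (true ∷_) (allSubsets n)) _ _)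
    (cong₂ _+_ (∑-map (true ∷_) (allSubsets n) _) (∑-map (false ∷_) (allSubsets n) _))

  count≤n^r : ∀ n r → count n r ≤ n ^ r
  count≤n^r zero zero = ≤-refl
  count≤n^r zero (suc r) = z≤n
  count≤n^r (suc n) zero = begin
    count (suc n) 0                    ≡⟨ count-suc n 0 ⟩
    (∑[ U ∈ allSubsets n ] 0) + count n 0 ≡⟨ cong (_+ count n 0) (∑-zero (allSubsets n)) ⟩
    count n 0                          ≤⟨ count≤n^r n 0 ⟩
    1                                  ∎
    where open ≤-Reasoning
  count≤n^r (suc n) (suc r) = begin
    count (suc n) (suc r)              ≡⟨ count-suc n (suc r) ⟩
    count n r + count n (suc r)        ≤⟨ +-mono-≤ (count≤n^r n r) (count≤n^r n (suc r)) ⟩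
    n ^ r + n * n ^ r                  ≤⟨ +-mono-≤ (^-monoˡ-≤ r (n≤1+n n)) (*-monoʳ-≤ n (^-monoˡ-≤ r (n≤1+n n))) ⟩
    suc n ^ suc r                      ∎
    where open ≤-Reasoning

-- Rational bounds

module _ where

  -- Opened locally: the integer constructor +_ makes sections such as (a + b +_) ambiguous.
  open import Data.Integer using (+_; +≤+)

  private
    +-* : ∀ m n → + m ℤ.* + n ≡ + (m * n)
    +-* m n = ℤ.+◃n≡+n (m * n)

    fraction : ∀ a b → toℚᵘ (+ a ℚ./ suc b) ℚᵘ.≃ mkℚᵘ (+ a) b
    fraction a b = ℚ.toℚᵘ-fromℚᵘ (mkℚᵘ (+ a) b)

    integral : ∀ k → toℚᵘ (ℕ→ℚ k) ℚᵘ.≃ mkℚᵘ (+ k) 0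
    integral k = fraction k 0

    integral-≤ : ∀ {m n} → m ≤ n → mkℚᵘ (+ m) 0 ℚᵘ.≤ mkℚᵘ (+ n) 0
    integral-≤ {m} {n} m≤n = *≤* (subst₂ ℤ._≤_ (sym (+-* m 1)) (sym (+-* n 1)) (+≤+ (*-monoˡ-≤ 1 m≤n)))

  ℕ→ℚ-mono-≤ : ∀ {m n} → m ≤ n → ℕ→ℚ m ℚ.≤ ℕ→ℚ n
  ℕ→ℚ-mono-≤ {m} {n} m≤n = ℚ.toℚᵘ-cancel-≤
    (ℚᵘ.≤-respˡ-≃ (ℚᵘ.≃-sym (integral m)) (ℚᵘ.≤-respʳ-≃ (ℚᵘ.≃-sym (integral n)) (integral-≤ m≤n)))

  ℕ→ℚ-≤-* : ∀ {m} d e → m ≤ d * e → ℕ→ℚ m ℚ.≤ ℕ→ℚ d ℚ.* ℕ→ℚ e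
  ℕ→ℚ-≤-* {m} d e m≤de = ℚ.toℚᵘ-cancel-≤
    (ℚᵘ.≤-respˡ-≃ (ℚᵘ.≃-sym (integral m)) (ℚᵘ.≤-respʳ-≃ (ℚᵘ.≃-sym product) (integral-≤ m≤de)))
    where
    product : toℚᵘ (ℕ→ℚ d ℚ.* ℕ→ℚ e) ℚᵘ.≃ mkℚᵘ (+ (d * e)) 0
    product = ℚᵘ.≃-trans (ℚ.toℚᵘ-homo-* (ℕ→ℚ d) (ℕ→ℚ e))
      (ℚᵘ.≃-trans (ℚᵘ.*-cong (integral d) (integral e)) (ℚᵘ.≃-reflexive (cong (λ z → mkℚᵘ z 0) (+-* d e))))

  ≤·log²-intro : ∀ c n D → (∀ a b → n ^ suc b < 2 ^ a → D * (suc b * suc b) ≤ c * (a * a)) → ℕ→ℚ D ≤ c ·log² n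
  ≤·log²-intro c n D bound a b c·q²<D with 2 ^ a ≤? n ^ suc b
  ... | yes fits = fits
  ... | no too-big = ⊥-elim (ℚᵘ.<⇒≱ c·q²<D′ D≤c·q²)
    where
    q : ℚᵘ
    q = mkℚᵘ (+ a) b
    c·q² : toℚᵘ (ℕ→ℚ c ℚ.* ((+ a ℚ./ suc b) ℚ.* (+ a ℚ./ suc b))) ℚᵘ.≃ mkℚᵘ (+ c) 0 ℚᵘ.* (q ℚᵘ.* q)
    c·q² = ℚᵘ.≃-trans (ℚ.toℚᵘ-homo-* (ℕ→ℚ c) _) (ℚᵘ.*-cong (integral c)
             (ℚᵘ.≃-trans (ℚ.toℚᵘ-homo-* (+ a ℚ./ suc b) _) (ℚᵘ.*-cong (fraction a b) (fraction a b))))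
    c·q²<D′ : mkℚᵘ (+ c) 0 ℚᵘ.* (q ℚᵘ.* q) ℚᵘ.< mkℚᵘ (+ D) 0
    c·q²<D′ = ℚᵘ.<-respʳ-≃ (integral D) (ℚᵘ.<-respˡ-≃ c·q² (ℚ.toℚᵘ-mono-< c·q²<D))
    D≤c·q² : mkℚᵘ (+ D) 0 ℚᵘ.≤ mkℚᵘ (+ c) 0 ℚᵘ.* (q ℚᵘ.* q)
    D≤c·q² = *≤* (subst₂ ℤ._≤_
      (sym (+-* D (1 * (suc b * suc b))))
      (trans (sym (+-* (c * (a * a)) 1)) (cong (ℤ._* + 1) (sym (trans (cong (+ c ℤ.*_) (+-* a a)) (+-* c (a * a))))))
      (+≤+ (subst₂ _≤_ (cong (D *_) (sym (*-identityˡ _))) (sym (*-identityʳ _)) (bound a b (≰⇒> too-big)))))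

-- The auxiliary graph 𝒢₀

module Construction (r : ℕ) (r≥1 : 1 ≤ r) (n : ℕ) (G : Graph n) (0<s : 0 < degSum₀ G r) where

  V : List (Subset n)
  V = rSubsets n r

  N s : ℕ
  N = numVert₀ n r
  s = degSum₀ G r

  d : Subset n → ℕ
  d = deg₀ G r

  Adj₀-sym : ∀ {U W} → Adj₀ G U W → Adj₀ G W U
  Adj₀-sym (disjoint , complete) =
    (λ x (x∈W , x∈U) → disjoint x (x∈U , x∈W)) , (λ w w∈W u u∈U → subst T (Graph.sym G u w) (complete u u∈U w w∈W))

  opaque
    adj₀ : Subset n → Subset n → Bool
    adj₀ U W = does (Adj₀? G U W)

    adj₀⇒Adj₀ : ∀ {U W} → T (adj₀ U W) → Adj₀ G U W
    adj₀⇒Adj₀ {U} {W} = does⇒ (Adj₀? G U W)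

    adj₀-sym : ∀ U W → adj₀ U W ≡ adj₀ W U
    adj₀-sym U W = does-⇔ (Adj₀? G U W) (Adj₀? G W U) Adj₀-sym Adj₀-sym

    d≡∑adj₀ : ∀ U → d U ≡ ∑[ W ∈ V ] 𝟙 (adj₀ U W)
    d≡∑adj₀ U = length-filter-∑ (Adj₀? G U) V

  open HighDegree V adj₀ adj₀-sym using (degree; edgesWithin; high-degree-edges)

  s≡∑degree : s ≡ ∑ V degree
  s≡∑degree = trans (sum-map V d) (∑-cong V λ U _ → d≡∑adj₀ U)

  d≤N : ∀ U → d U ≤ N
  d≤N U = List.length-filter (Adj₀? G U) V

  0<N : 0 < N
  0<N = let _ , y∈V , _ = ∑-positive V degree (subst (0 <_) s≡∑degree 0<s) in ∈-length y∈V

  instance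
    N≢0 : NonZero N
    N≢0 = >-nonZero 0<N

  opaque
    good : Subset n → Bool
    good U = (∣ U ∣ ≡ᵇ r) ∧ (s ≤ᵇ 4 * N * d U)

    good-size : ∀ {U} → T (good U) → ∣ U ∣ ≡ r
    good-size {U} = ≡ᵇ⇒≡ ∣ U ∣ r ∘′ proj₁ ∘′ T-∧⁻ (∣ U ∣ ≡ᵇ r)

    good-high : ∀ {U} → T (good U) → s ≤ 4 * N * d U
    good-high {U} = ≤ᵇ⇒≤ s (4 * N * d U) ∘′ proj₂ ∘′ T-∧⁻ (∣ U ∣ ≡ᵇ r)

    good-intro : ∀ {U} → ∣ U ∣ ≡ r → s ≤ 4 * N * d U → T (good U)
    good-intro {U} size high = T-∧⁺ (≡⇒≡ᵇ ∣ U ∣ r size) (≤⇒≤ᵇ high)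

  good-nonempty : ∀ {U} → T (good U) → 0 < ∣ U ∣
  good-nonempty goodU = subst (0 <_) (sym (good-size goodU)) r≥1

  good-d-pos : ∀ {U} → T (good U) → 0 < d U
  good-d-pos {U} goodU = n≢0⇒n>0 λ dU≡0 →
    <⇒≱ 0<s (subst (s ≤_) (trans (cong (4 * N *_) dU≡0) (*-zeroʳ (4 * N))) (good-high goodU))

  half-edges-good : s ≤ 2 * edgesWithin good
  half-edges-good = subst (_≤ 2 * edgesWithin good) (sym s≡∑degree) (high-degree-edges good low)
    where
    low : ∀ y → y ∈ V → T (not (good y)) → 4 * N * degree y ≤ ∑ V degree
    low y y∈V not-good = subst₂ _≤_ (cong (4 * N *_) (d≡∑adj₀ y)) s≡∑degree (<⇒≤ (≰⇒> not-high))
      where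
      not-high : ¬ (s ≤ 4 * N * d y)
      not-high h = T-not⇒¬T not-good (good-intro (∈-rSubsets⁻ y∈V) h)

  opaque
    level : Subset n → ℕ
    level U = clog₂ (d U)

    good⇒d≤2^level : ∀ {U} → T (good U) → d U ≤ 2 ^ level U
    good⇒d≤2^level = m≤2^clog₂m ∘′ good-d-pos

    good⇒2^level<2d : ∀ {U} → T (good U) → 2 ^ level U < 2 * d U
    good⇒2^level<2d = 2^clog₂m<2m ∘′ good-d-pos

  weight : Subset n → ℕ
  weight U = 2 ^ level U

  B I L K : ℕ
  B = clog₂ n
  I = clog₂ N
  L = suc I
  K = 1 + 16 * (L * B)

  good⇒level<L : ∀ {U} → T (good U) → level U < L
  good⇒level<L {U} goodU =
    2^-cancel-< (<-≤-trans (good⇒2^level<2d goodU) (*-monoʳ-≤ 2 (≤-trans (d≤N U) (m≤2^clog₂m 0<N))))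

  good⇒least<2^B : ∀ {U} → T (good U) → least U < 2 ^ B
  good⇒least<2^B {U} goodU = <-≤-trans least<n′ (m≤2^clog₂m (≤-trans (s≤s z≤n) least<n′))
    where
    least<n′ : least U < n
    least<n′ = least<n U (good-nonempty goodU)

  Piece : Set
  Piece = ℕ × ℕ × ℕ

  pieces : List Piece
  pieces = cartesianProduct (downFrom L) (cartesianProduct (downFrom L) (downFrom B))

  levelOf : Piece → Parity → ℕ
  levelOf (i , _ , _) 0ℙ = i
  levelOf (_ , j , _) 1ℙ = j

  bitOf : Piece → ℕ
  bitOf (_ , _ , k) = k

  opaque
    member : Piece → Parity → Subset n → Bool
    member c p U = good U ∧ (level U ≡ᵇ levelOf c p) ∧ does (digit (bitOf c) (least U) Parity.≟ p)

    member-good : ∀ {c p U} → T (member c p U) → T (good U)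
    member-good {c} {p} {U} = proj₁ ∘′ T-∧⁻ (good U)

    member-level : ∀ {c p U} → T (member c p U) → level U ≡ levelOf c p
    member-level {c} {p} {U} =
      ≡ᵇ⇒≡ (level U) (levelOf c p) ∘′ proj₁ ∘′ T-∧⁻ (level U ≡ᵇ levelOf c p) ∘′ proj₂ ∘′ T-∧⁻ (good U)

    member-digit : ∀ {c p U} → T (member c p U) → digit (bitOf c) (least U) ≡ p
    member-digit {c} {p} {U} =
      does⇒ (digit (bitOf c) (least U) Parity.≟ p) ∘′ proj₂ ∘′ T-∧⁻ (level U ≡ᵇ levelOf c p)
        ∘′ proj₂ ∘′ T-∧⁻ (good U)

    𝟙-member≤𝟙-level : ∀ c p U → 𝟙 (member c p U) ≤ 𝟙 (level U ≡ᵇ levelOf c p)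
    𝟙-member≤𝟙-level c p U = ≤-trans (𝟙-∧-≤ʳ (good U) _) (𝟙-∧-≤ˡ (level U ≡ᵇ levelOf c p) _)

    member-intro : ∀ c {p U} → T (good U) → level U ≡ levelOf c p → digit (bitOf c) (least U) ≡ p → T (member c p U)
    member-intro c {p} {U} goodU lvl dgt =
      T-∧⁺ goodU (T-∧⁺ (≡⇒≡ᵇ (level U) (levelOf c p) lvl) (⇒does (digit (bitOf c) (least U) Parity.≟ p) dgt))

  inPiece : Piece → Subset n → Bool
  inPiece c U = member c 0ℙ U ∨ member c 1ℙ U

  crossing edge : Piece → Subset n → Subset n → Bool
  crossing c U W = (member c 0ℙ U ∧ member c 1ℙ W) ∨ (member c 1ℙ U ∧ member c 0ℙ W)
  edge c U W = crossing c U W ∧ adj₀ U W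

  edge-sym : ∀ c U W → edge c U W ≡ edge c W U
  edge-sym c U W = cong₂ _∧_ crossing-sym (adj₀-sym U W)
    where
    crossing-sym : crossing c U W ≡ crossing c W U
    crossing-sym = trans (∨-comm (member c 0ℙ U ∧ member c 1ℙ W) _)
      (cong₂ _∨_ (∧-comm (member c 1ℙ U) _) (∧-comm (member c 0ℙ U) _))

  ∈-pieces : ∀ {U W k} → T (good U) → T (good W) → k < B → (level U , level W , k) ∈ pieces
  ∈-pieces good-U good-W k<B = ∈-cartesianProduct⁺ (∈-downFrom⁺ (good⇒level<L good-U))
    (∈-cartesianProduct⁺ (∈-downFrom⁺ (good⇒level<L good-W)) (∈-downFrom⁺ k<B))

  edge-intro : ∀ c {U W} → T (crossing c U W) → T (adj₀ U W) → T (edge c U W)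
  edge-intro c {U} {W} = T-∧⁺ {crossing c U W}

  module OnPiece (c : Piece) = Peeling (Vec.≡-dec Bool._≟_) V (edge c) (edge-sym c) weight K

  separating-piece : ∀ {y w} → T (good y) → T (good w) → T (adj₀ y w) →
    Σ[ c ∈ Piece ] c ∈ pieces × T (inPiece c y) × T (inPiece c w) × T (edge c y w)
  separating-piece {y} {w} good-y good-w adj-yw with
    digits-separate B (good⇒least<2^B good-y) (good⇒least<2^B good-w)
      (least-disjoint y w (proj₁ (adj₀⇒Adj₀ adj-yw)) (good-nonempty good-y) (good-nonempty good-w))
  ... | k , k<B , differ with digit k (least y) in dy | digit k (least w) in dw
  ... | 0ℙ | 0ℙ = ⊥-elim (differ refl)
  ... | 1ℙ | 1ℙ = ⊥-elim (differ refl)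
  ... | 0ℙ | 1ℙ =
    c , ∈-pieces good-y good-w k<B , T-∨⁺ˡ y∈ , T-∨⁺ʳ w∈ , edge-intro c (T-∨⁺ˡ (T-∧⁺ y∈ w∈)) adj-yw
    where
    c : Piece
    c = level y , level w , k
    y∈ : T (member c 0ℙ y)
    y∈ = member-intro c good-y refl dy
    w∈ : T (member c 1ℙ w)
    w∈ = member-intro c good-w refl dw
  ... | 1ℙ | 0ℙ =
    c , ∈-pieces good-w good-y k<B , T-∨⁺ʳ y∈ , T-∨⁺ˡ w∈ , edge-intro c (T-∨⁺ʳ (T-∧⁺ y∈ w∈)) adj-yw
    where
    c : Piece
    c = level w , level y , k
    y∈ : T (member c 1ℙ y)
    y∈ = member-intro c good-y refl dy
    w∈ : T (member c 0ℙ w)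
    w∈ = member-intro c good-w refl dw

  edges-good≤∑vol : edgesWithin good ≤ ∑[ c ∈ pieces ] OnPiece.vol c (inPiece c)
  edges-good≤∑vol = begin
    edgesWithin good
      ≤⟨ ∑-mono-≤ V (λ y _ → ∑-mono-≤ V λ w _ → covered y w) ⟩
    ∑[ y ∈ V ] ∑[ w ∈ V ] ∑[ c ∈ pieces ] 𝟙 (inPiece c y) * (𝟙 (inPiece c w) * 𝟙 (edge c y w))
      ≡⟨ trans (∑-cong V λ y _ → ∑-comm V pieces _) (∑-comm V pieces _) ⟩
    ∑[ c ∈ pieces ] ∑[ y ∈ V ] ∑[ w ∈ V ] 𝟙 (inPiece c y) * (𝟙 (inPiece c w) * 𝟙 (edge c y w))
      ≡⟨ ∑-cong pieces (λ c _ → ∑-cong V λ y _ → ∑-*ˡ V (𝟙 (inPiece c y)) _) ⟩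
    ∑[ c ∈ pieces ] OnPiece.vol c (inPiece c) ∎
    where
    open ≤-Reasoning
    term : Subset n → Subset n → Piece → ℕ
    term y w c = 𝟙 (inPiece c y) * (𝟙 (inPiece c w) * 𝟙 (edge c y w))
    covered : ∀ y w → 𝟙 (good y) * 𝟙 (good w) * 𝟙 (adj₀ y w) ≤ ∑ pieces (term y w)
    covered y w = 𝟙³-≤ (good y) (good w) (adj₀ y w) λ good-y good-w adj-yw →
      let c , c∈ , y∈c , w∈c , e = separating-piece good-y good-w adj-yw
      in  subst (_≤ ∑ pieces (term y w)) (cong₂ _*_ (𝟙-T y∈c) (cong₂ _*_ (𝟙-T w∈c) (𝟙-T e)))
            (term≤∑ pieces (term y w) c∈)

  ∑-pieces : ∀ f → ∑ pieces f ≡ ∑[ i ∈ downFrom L ] ∑[ j ∈ downFrom L ] ∑[ k ∈ downFrom B ] f (i , j , k)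
  ∑-pieces f = trans (∑-cartesianProduct (downFrom L) (cartesianProduct (downFrom L) (downFrom B)) f)
    (∑-cong (downFrom L) λ i _ → ∑-cartesianProduct (downFrom L) (downFrom B) (f ∘′ (i ,_)))

  pieces-containing : ∀ y → ∑[ c ∈ pieces ] 𝟙 (inPiece c y) ≤ 2 * (L * B)
  pieces-containing y = begin
    ∑[ c ∈ pieces ] 𝟙 (inPiece c y)
      ≤⟨ ∑-mono-≤ pieces (λ c _ → level-hits c) ⟩
    ∑[ c ∈ pieces ] 𝟙 (m ≡ᵇ levelOf c 0ℙ) + 𝟙 (m ≡ᵇ levelOf c 1ℙ)
      ≡⟨ ∑-pieces hits ⟩
    ∑[ i ∈ downFrom L ] ∑[ j ∈ downFrom L ] ∑[ k ∈ downFrom B ] 𝟙 (m ≡ᵇ i) + 𝟙 (m ≡ᵇ j)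
      ≡⟨ ∑-cong (downFrom L) (λ i _ →
           trans (∑-cong (downFrom L) λ j _ → ∑-downFrom-const B _) (∑-*ˡ (downFrom L) B (hits₂ i))) ⟩
    ∑[ i ∈ downFrom L ] B * ∑ (downFrom L) (hits₂ i)
      ≡⟨ ∑-*ˡ (downFrom L) B (λ i → ∑ (downFrom L) (hits₂ i)) ⟩
    B * (∑[ i ∈ downFrom L ] ∑[ j ∈ downFrom L ] 𝟙 (m ≡ᵇ i) + 𝟙 (m ≡ᵇ j))
      ≤⟨ *-monoʳ-≤ B (∑-downFrom²-≡ᵇ m L) ⟩
    B * (2 * L)
      ≡⟨ trans (*-comm B (2 * L)) (*-assoc 2 L B) ⟩
    2 * (L * B) ∎
    where
    open ≤-Reasoning
    m : ℕ
    m = level y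
    hits : Piece → ℕ
    hits c = 𝟙 (m ≡ᵇ levelOf c 0ℙ) + 𝟙 (m ≡ᵇ levelOf c 1ℙ)
    hits₂ : ℕ → ℕ → ℕ
    hits₂ i j = 𝟙 (m ≡ᵇ i) + 𝟙 (m ≡ᵇ j)
    level-hits : ∀ c → 𝟙 (inPiece c y) ≤ hits c
    level-hits c = ≤-trans (𝟙-∨-≤ (member c 0ℙ y) _) (+-mono-≤ (𝟙-member≤𝟙-level c 0ℙ y) (𝟙-member≤𝟙-level c 1ℙ y))

  inPiece-good : ∀ {c U} → T (inPiece c U) → T (good U)
  inPiece-good {c} {U} = [ member-good , member-good ]′ ∘′ Equivalence.to (T-∨ {member c 0ℙ U})

  ∑weight≤ : ∑[ c ∈ pieces ] OnPiece.mass c (inPiece c) weight ≤ 2 * (L * B) * (2 * s)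
  ∑weight≤ = begin
    ∑[ c ∈ pieces ] ∑[ y ∈ V ] 𝟙 (inPiece c y) * weight y
      ≤⟨ ∑-mono-≤ pieces (λ c _ → ∑-mono-≤ V λ y _ → 𝟙-guard-≤ (inPiece c y) (weight≤2d c)) ⟩
    ∑[ c ∈ pieces ] ∑[ y ∈ V ] 𝟙 (inPiece c y) * (2 * d y)
      ≡⟨ ∑-comm pieces V _ ⟩
    ∑[ y ∈ V ] ∑[ c ∈ pieces ] 𝟙 (inPiece c y) * (2 * d y)
      ≡⟨ ∑-cong V (λ y _ → trans (∑-cong pieces λ c _ → *-comm _ (2 * d y)) (∑-*ˡ pieces (2 * d y) _)) ⟩
    ∑[ y ∈ V ] 2 * d y * (∑[ c ∈ pieces ] 𝟙 (inPiece c y))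
      ≤⟨ ∑-mono-≤ V (λ y _ → *-monoʳ-≤ (2 * d y) (pieces-containing y)) ⟩
    ∑[ y ∈ V ] 2 * d y * (2 * (L * B))
      ≡⟨ trans (∑-cong V λ y _ → *-comm (2 * d y) _) (∑-*ˡ V (2 * (L * B)) _) ⟩
    2 * (L * B) * (∑[ y ∈ V ] 2 * d y)
      ≡⟨ cong (2 * (L * B) *_) (trans (∑-*ˡ V 2 d) (cong (2 *_) (sym (sum-map V d)))) ⟩
    2 * (L * B) * (2 * s) ∎
    where
    open ≤-Reasoning
    weight≤2d : ∀ c {y} → T (inPiece c y) → weight y ≤ 2 * d y
    weight≤2d c = <⇒≤ ∘′ good⇒2^level<2d ∘′ inPiece-good {c}

  dense-piece : Σ[ c ∈ Piece ] OnPiece.Dense c (inPiece c)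
  dense-piece =
    let c , _ , dense = ∑-<⇒∃< pieces (λ c → 2 * OnPiece.mass c (inPiece c) weight) (λ c → K * OnPiece.vol c (inPiece c))
                          ∑-dense
    in  c , dense
    where
    open ≤-Reasoning
    W Vol : ℕ
    W = ∑[ c ∈ pieces ] OnPiece.mass c (inPiece c) weight
    Vol = ∑[ c ∈ pieces ] OnPiece.vol c (inPiece c)
    regroup : ∀ L B s → 2 * (2 * (2 * (L * B) * (2 * s))) ≡ 16 * (L * B) * s
    regroup = solve-∀
    expand : ∀ L B s → (1 + 16 * (L * B)) * s ≡ s + 16 * (L * B) * s
    expand = solve-∀
    ∑-dense : ∑[ c ∈ pieces ] 2 * OnPiece.mass c (inPiece c) weight < ∑[ c ∈ pieces ] K * OnPiece.vol c (inPiece c)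
    ∑-dense = subst₂ _<_ (sym (∑-*ˡ pieces 2 _)) (sym (∑-*ˡ pieces K _)) (*-cancelˡ-< 2 (2 * W) (K * Vol) (begin-strict
      2 * (2 * W)                       ≤⟨ *-monoʳ-≤ 2 (*-monoʳ-≤ 2 ∑weight≤) ⟩
      2 * (2 * (2 * (L * B) * (2 * s))) ≡⟨ regroup L B s ⟩
      16 * (L * B) * s                  <⟨ m<n+m _ 0<s ⟩
      s + 16 * (L * B) * s              ≡⟨ expand L B s ⟨
      K * s                             ≤⟨ *-monoʳ-≤ K (≤-trans half-edges-good (*-monoʳ-≤ 2 edges-good≤∑vol)) ⟩
      K * (2 * Vol)                     ≡⟨ *-x∙yz≈y∙xz K 2 Vol ⟩
      2 * (K * Vol)                     ∎))

  module Extraction {c : Piece} {S : Subset n → Bool} (dense : OnPiece.Dense c S) (robust : OnPiece.Robust c S) where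

    side : Parity → Subset n → Bool
    side p U = S U ∧ member c p U

    module _ {p : Parity} {U : Subset n} (U∈ : T (side p U)) where

      side-S : T (S U)
      side-S = proj₁ (T-∧⁻ (S U) U∈)

      side-member : T (member c p U)
      side-member = proj₂ (T-∧⁻ (S U) U∈)

      side-good : T (good U)
      side-good = member-good side-member

      side-level : level U ≡ levelOf c p
      side-level = member-level side-member

      side-digit : digit (bitOf c) (least U) ≡ p
      side-digit = member-digit side-member

    Across : Subset n → Subset n → Set
    Across U W = (T (side 0ℙ U) × T (side 1ℙ W)) ⊎ (T (side 1ℙ U) × T (side 0ℙ W))

    sides : ∀ {U W} → T (S U) → T (S W) → T (crossing c U W) → Across U W
    sides {U} {W} SU SW cross with Equivalence.to (T-∨ {member c 0ℙ U ∧ member c 1ℙ W}) cross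
    ... | inj₁ m = let mU , mW = T-∧⁻ (member c 0ℙ U) m in inj₁ (T-∧⁺ SU mU , T-∧⁺ SW mW)
    ... | inj₂ m = let mU , mW = T-∧⁻ (member c 1ℙ U) m in inj₂ (T-∧⁺ SU mU , T-∧⁺ SW mW)

    𝒢 : BipSub G r
    𝒢 = record
      { X₁ = side 0ℙ
      ; X₂ = side 1ℙ
      ; e = λ U W → S U ∧ (S W ∧ edge c U W)
      ; X₁-r = λ U → good-size ∘′ side-good
      ; X₂-r = λ U → good-size ∘′ side-good
      ; disj = λ U U∈₀ U∈₁ → 0ℙ≢1ℙ (trans (sym (side-digit U∈₀)) (side-digit U∈₁))
      ; e-sym = λ U W → trans (cong (λ b → S U ∧ (S W ∧ b)) (edge-sym c U W)) (∧-x∙yz≈y∙xz (S U) (S W) _)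
      ; e-sub = λ U W e →
          adj₀⇒Adj₀ (proj₂ (T-∧⁻ (crossing c U W) (proj₂ (T-∧⁻ (S W) (proj₂ (T-∧⁻ (S U) e))))))
      ; e-bip = λ U W e →
          let SU , rest = T-∧⁻ (S U) e
              SW , e′ = T-∧⁻ (S W) rest
          in  sides SU SW (proj₁ (T-∧⁻ (crossing c U W) e′))
      }

    inhabited : ∀ p → Σ[ u ∈ Subset n ] T (side p u)
    inhabited p =
      let y , w , Sy , Sw , e = OnPiece.Dense⇒edge c {S} dense
      in  pick p (sides Sy Sw (proj₁ (T-∧⁻ (crossing c y w) e)))
      where
      pick : ∀ p {y w} → Across y w → Σ[ u ∈ Subset n ] T (side p u)
      pick 0ℙ (inj₁ (y∈ , _)) = _ , y∈
      pick 1ℙ (inj₁ (_ , w∈)) = _ , w∈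
      pick 0ℙ (inj₂ (_ , w∈)) = _ , w∈
      pick 1ℙ (inj₂ (y∈ , _)) = _ , y∈

    2≤n : 2 ≤ n
    2≤n =
      let u₀ , u₀∈ = inhabited 0ℙ
          u₁ , u₁∈ = inhabited 1ℙ
      in  distinct-below⇒2≤ (least<n u₀ (good-nonempty (side-good u₀∈))) (least<n u₁ (good-nonempty (side-good u₁∈)))
            (λ same → 0ℙ≢1ℙ (trans (sym (side-digit u₀∈)) (trans (cong (digit (bitOf c)) same) (side-digit u₁∈))))

    degB≡deg : ∀ {x} → T (S x) → degB 𝒢 x ≡ OnPiece.deg c S x
    degB≡deg {x} Sx = trans (length-filter-T (λ W → S x ∧ (S W ∧ edge c x W)) _ V) (∑-cong V λ W _ → pointwise W)
      where
      pointwise : ∀ W → 𝟙 (S x ∧ (S W ∧ edge c x W)) ≡ 𝟙 (S W) * 𝟙 (edge c x W)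
      pointwise W = trans (𝟙-∧ (S x) _) (trans (cong₂ _*_ (𝟙-T Sx) (𝟙-∧ (S W) _)) (*-identityˡ _))

    average-bound : ∀ p → s ≤ 2 ^ levelOf c p * (4 * N)
    average-bound p =
      let u , u∈ = inhabited p
      in  ≤-trans (good-high (side-good u∈))
            (≤-trans (*-monoʳ-≤ (4 * N) (subst (λ l → d u ≤ 2 ^ l) (side-level u∈) (good⇒d≤2^level (side-good u∈))))
              (≤-reflexive (*-comm (4 * N) _)))

    side-bounds : ∀ p x → T (side p x) →
      (ℕ→ℚ (2 ^ levelOf c p) ≤ (256 * (r * r) * degB 𝒢 x) ·log² n) ×
      (ℕ→ℚ (deg₀ G r x) ℚ.≤ ℕ→ℚ (2 ^ levelOf c p))
    side-bounds p x x∈ = ≤·log²-intro (256 * (r * r) * deg) n D log-bound , ℕ→ℚ-mono-≤ {d x} {D} d≤D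
      where
      D deg : ℕ
      D = 2 ^ levelOf c p
      deg = degB 𝒢 x
      d≤D : d x ≤ D
      d≤D = subst (λ l → d x ≤ 2 ^ l) (side-level x∈) (good⇒d≤2^level (side-good x∈))
      D<Kdeg : D < K * deg
      D<Kdeg = subst₂ (λ l e → 2 ^ l < K * e) (side-level x∈) (sym (degB≡deg (side-S x∈)))
        (robust x (∈-rSubsets⁺ (good-size (side-good x∈))) (side-S x∈))
      log-bound : ∀ a b → n ^ suc b < 2 ^ a → D * (suc b * suc b) ≤ 256 * (r * r) * deg * (a * a)
      log-bound a b n^t<2^a = begin
        D * (t * t)                      ≤⟨ *-monoˡ-≤ (t * t) (<⇒≤ D<Kdeg) ⟩
        K * deg * (t * t)                ≡⟨ trans (*-assoc K deg (t * t)) (*-x∙yz≈y∙xz K deg (t * t)) ⟩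
        deg * (K * (t * t))              ≤⟨ *-monoʳ-≤ deg Kt²≤ ⟩
        deg * (R * (a * a))              ≡⟨ trans (*-x∙yz≈y∙xz deg R (a * a)) (sym (*-assoc R deg (a * a))) ⟩
        R * deg * (a * a)                ∎
        where
        open ≤-Reasoning
        t R : ℕ
        t = suc b
        R = 256 * (r * r)
        Kt²≤ : K * (t * t) ≤ R * (a * a)
        Kt²≤ = log²-bound {N = N} {B = B} {I = I} {t = t} {a = a} r≥1 2≤n (numVert₀≤n^r n r)
                 (2^clog₂m<2m (≤-trans (s≤s z≤n) 2≤n)) (2^clog₂m<2m 0<N) (<⇒≤ n^t<2^a)

lemma5p4 : (r : ℕ) → r ≥ 1 → (n : ℕ) → (G : Graph n) →
    0 < degSum₀ G r →
    Σ ℚ λ D₁ → Σ ℚ λ D₂ →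
      (ℕ→ℚ (degSum₀ G r) ℚ.≤ D₁ ℚ.* ℕ→ℚ (4 * numVert₀ n r)) ×
      (ℕ→ℚ (degSum₀ G r) ℚ.≤ D₂ ℚ.* ℕ→ℚ (4 * numVert₀ n r)) ×
      Σ (BipSub G r) λ 𝒢 → NonEmptyB 𝒢 ×
        (∀ x → T (X₁ 𝒢 x) →
          (D₁ ≤ (256 * (r * r) * degB 𝒢 x) ·log² n) × (ℕ→ℚ (deg₀ G r x) ℚ.≤ D₁)) ×
        (∀ x → T (X₂ 𝒢 x) →
          (D₂ ≤ (256 * (r * r) * degB 𝒢 x) ·log² n) × (ℕ→ℚ (deg₀ G r x) ℚ.≤ D₂))
lemma5p4 r r≥1 n G 0<s =
  ℕ→ℚ (2 ^ levelOf c 0ℙ) , ℕ→ℚ (2 ^ levelOf c 1ℙ) ,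
  ℕ→ℚ-≤-* (2 ^ levelOf c 0ℙ) (4 * N) (average-bound 0ℙ) ,
  ℕ→ℚ-≤-* (2 ^ levelOf c 1ℙ) (4 * N) (average-bound 1ℙ) ,
  𝒢 , (_ , inj₁ (proj₂ (inhabited 0ℙ))) , side-bounds 0ℙ , side-bounds 1ℙ
  where
  open Construction r r≥1 n G 0<s
  c : Piece
  c = proj₁ dense-piece
  peeled : Σ[ S ∈ (Subset n → Bool) ] OnPiece.Dense c S × OnPiece.Robust c S
  peeled = OnPiece.peel c (inPiece c) (proj₂ dense-piece)
  open Extraction {c} {proj₁ peeled} (proj₁ (proj₂ peeled)) (proj₂ (proj₂ peeled))
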